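{- $S_n(q,t) = (qt)^{2(n-1)}C_{n-1}(q,t^2)$.
   Context: Dyck paths of semi-length $n$: paths from $(n,n)$ to $(0,0)$ with unit steps south $(0,-1)$ and west $(-1,0)$ never going above the diagonal; $\mathrm{area}(D)$ is the number of complete unit squares between $D$ and the diagonal. Haglund's bounce path starts at $(n,n)$ with a south step and turns (south to west and vice versa) each time it meets a west step of $D$ or the line $x=y$; if it is $\text{south}^{a(1)}\text{west}^{a(1)}\cdots\text{south}^{a(k)}\text{west}^{a(k)}$ then $\mathsf{hagbounce}(D)=a(2)+2a(3)+\cdots+(k-1)a(k)$. $C_n(q,t)=\sum_D q^{\mathrm{area}(D)}t^{\mathsf{hagbounce}(D)}$ over Dyck paths of semi-length $n$. $\mathsf{LowerPara}_{n,n-1}$ is the set of polyominoes $\mathsf{diag}(x)=\bigcup_{i=1}^{n-1}[n-1-i,2+x_i]\times[n-1-i,n-i]$ for $x$ a weakly decreasing recurrent sandpile configuration on $K_n$ with one sink (i.e. $x_1\ge\cdots\ge x_{n-1}$, $n-2\ge x_i\ge n-1-i$); these are parallelogram polyominoes in $[0,n]\times[0,n-1]$ with staircase upper path. For such a polyomino, $\mathrm{area}$ is its number of cells and $\mathsf{parabounce}=\sum_i\lceil i/2\rceil c_i$ where $(c_i)$ are the run lengths of the path from $(n-1,n-1)$ going south until meeting the lower boundary, west until meeting the upper boundary, alternating to $(0,0)$. $S_n(q,t)=\sum_{\mathcal{P}\in\mathsf{LowerPara}_{n,n-1}} q^{\mathrm{area}(\mathcal{P})}t^{\mathsf{parabounce}(\mathcal{P})}$.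 -}

module Defs where

open import Data.Bool using (Bool; true; false; _∧_; _∨_; if_then_else_)
open import Data.Nat using (ℕ; zero; suc; _+_; _*_; _∸_; _≡ᵇ_; _<ᵇ_; _≤ᵇ_)
open import Data.List using (List; []; _∷_; map; reverse; concatMap; filterᵇ)
open import Data.Nat.ListAction using (sum)
open import Data.Product using (_×_; _,_)

-- nth xs k : the k-th entry (0-based) of xs, default 0
nth : List ℕ → ℕ → ℕ
nth []       _       = 0
nth (x ∷ xs) zero    = x
nth (x ∷ xs) (suc k) = nth xs k

upToIncl : ℕ → List ℕ
upToIncl zero    = 0 ∷ []
upToIncl (suc b) = upToIncl b Data.List.++ (suc b ∷ [])

allLists : ℕ → ℕ → List (List ℕ)
allLists zero    b = [] ∷ []
allLists (suc k) b = concatMap (λ v → map (v ∷_) (allLists k b)) (upToIncl b)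

-- A bivariate polynomial with coefficients in ℕ is represented by the
-- multiset (list up to permutation) of its monomials q^a t^b, each
-- monomial being the pair (a , b).
Poly : Set
Poly = List (ℕ × ℕ)

-- Dyck paths
-- A step is  true = south (0,-1),  false = west (-1,0).
-- A lattice path from (n,n) is a list of steps.

Step : Set
Step = Bool

allStepLists : ℕ → List (List Step)
allStepLists zero    = [] ∷ []
allStepLists (suc k) = concatMap (λ s → map (s ∷_) (allStepLists k)) (true ∷ false ∷ [])

-- validFrom x y p : starting at (x,y), the path p stays in the lattice,
-- never goes above the diagonal (every visited point has y ≤ x)
-- and ends at (0,0).
validFrom : ℕ → ℕ → List Step → Bool
validFrom x y       []           = (x ≡ᵇ 0) ∧ (y ≡ᵇ 0)
validFrom x zero    (true  ∷ p)  = false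
validFrom x (suc y) (true  ∷ p)  = validFrom x y p
validFrom zero y    (false ∷ p)  = false
validFrom (suc x) y (false ∷ p)  = (y ≤ᵇ x) ∧ validFrom x y p

isDyck : ℕ → List Step → Bool
isDyck n p = validFrom n n p

dyckPaths : ℕ → List (List Step)
dyckPaths n = filterᵇ (isDyck n) (allStepLists (n + n))

-- area: a south step from (x,y) to (x,y-1) has exactly x - y complete
-- unit squares between it and the diagonal in the row [y-1,y].
areaFrom : ℕ → ℕ → List Step → ℕ
areaFrom x y       []          = 0
areaFrom x y       (true ∷ p)  = (x ∸ y) + areaFrom x (y ∸ 1) p
areaFrom x y       (false ∷ p) = areaFrom (x ∸ 1) y p

dyckArea : ℕ → List Step → ℕ
dyckArea n p = areaFrom n n p

-- lowFrom X x y p : height y at which the path (currently at (x,y))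
-- takes a west step starting on the vertical line x = X,
-- i.e. the point (X , y) where the bounce path going south along x = X
-- meets (the beginning of) a west step of D.
lowFrom : ℕ → ℕ → ℕ → List Step → ℕ
lowFrom X x y []          = 0
lowFrom X x y (true ∷ p)  = lowFrom X x (y ∸ 1) p
lowFrom X x y (false ∷ p) = if x ≡ᵇ X then y else lowFrom X (x ∸ 1) y p

-- Haglund bounce path: from (X,X) go south to (X, low X), then west to
-- the diagonal at (low X , low X); run length a = X - low X.
-- (fuel f ≥ number of runs; each run decreases X)
hagRuns : ℕ → List Step → ℕ → ℕ → List ℕ
hagRuns n p zero    X       = []
hagRuns n p (suc f) zero    = []
hagRuns n p (suc f) (suc X) =
  (suc X ∸ lowFrom (suc X) n n p) ∷ hagRuns n p f (lowFrom (suc X) n n p)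

wsum : ℕ → List ℕ → ℕ
wsum k []       = 0
wsum k (a ∷ as) = k * a + wsum (suc k) as

-- hagbounce = a(2) + 2 a(3) + … + (k-1) a(k)
hagbounce : ℕ → List Step → ℕ
hagbounce n p = wsum 0 (hagRuns n p n n)

Cpoly : ℕ → Poly
Cpoly n = map (λ p → dyckArea n p , hagbounce n p) (dyckPaths n)

-- LowerPara_{n,n-1}, with n = suc m.
-- A configuration x = (x_1,…,x_{n-1}) is a list of length m = n-1.

weaklyDecreasing : List ℕ → Bool
weaklyDecreasing []           = true
weaklyDecreasing (a ∷ [])     = true
weaklyDecreasing (a ∷ b ∷ xs) = (b ≤ᵇ a) ∧ weaklyDecreasing (b ∷ xs)

-- boundsFrom n i xs : for xs = (x_i, x_{i+1}, …), n-2 ≥ x_j ≥ n-1-j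
boundsFrom : ℕ → ℕ → List ℕ → Bool
boundsFrom n i []       = true
boundsFrom n i (x ∷ xs) = (x ≤ᵇ n ∸ 2) ∧ ((n ∸ 1 ∸ i) ≤ᵇ x) ∧ boundsFrom n (suc i) xs

-- weakly decreasing recurrent sandpile configurations on K_n (one sink)
isLowerConfig : ℕ → List ℕ → Bool
isLowerConfig n xs = weaklyDecreasing xs ∧ boundsFrom n 1 xs

lowerConfigs : ℕ → List (List ℕ)
lowerConfigs (suc m) = filterᵇ (isLowerConfig (suc m)) (allLists m (m ∸ 1))
lowerConfigs zero    = []

-- diag(x) = ⋃_{i=1}^{n-1} [n-1-i, 2+x_i] × [n-1-i, n-i] :
-- list of rows (left end , right end), row i at height n-1-i.
rowsFrom : ℕ → ℕ → List ℕ → List (ℕ × ℕ)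
rowsFrom n i []       = []
rowsFrom n i (x ∷ xs) = (n ∸ 1 ∸ i , 2 + x) ∷ rowsFrom n (suc i) xs

diagRows : ℕ → List ℕ → List (ℕ × ℕ)
diagRows n xs = rowsFrom n 1 xs

paraArea : ℕ → List ℕ → ℕ
paraArea n xs = sum (map (λ { (l , r) → r ∸ l }) (diagRows n xs))

-- right end and left end of the row occupying heights [Y, Y+1]
-- (row i = n-1-Y)
rightEnd : ℕ → List ℕ → ℕ → ℕ
rightEnd n xs Y = 2 + nth xs (n ∸ 2 ∸ Y)

leftEnd : ℕ → List ℕ → ℕ → ℕ
leftEnd n xs Y = n ∸ 1 ∸ (n ∸ 1 ∸ Y)

-- going south along x = X from height Y: continue while the row below
-- extends strictly to the right of X; stop on meeting the lower boundary
-- (a point of the lower path, i.e. r_{Y-1} ≤ X, or Y = 0).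
southStop : ℕ → List ℕ → ℕ → ℕ → ℕ
southStop n xs X zero    = zero
southStop n xs X (suc Y) =
  if X <ᵇ rightEnd n xs Y then southStop n xs X Y else suc Y

-- going west along height Y from X: the first point of the upper
-- (staircase) path met is (l_Y , Y), the left end of the row at height Y.
-- Runs c_1, c_2, … alternate south, west, starting at (n-1,n-1), until (0,0).
paraRuns : ℕ → List ℕ → ℕ → ℕ → ℕ → List ℕ
paraRuns n xs zero    X Y = []
paraRuns n xs (suc f) X Y =
  if (X ≡ᵇ 0) ∧ (Y ≡ᵇ 0) then []
  else ((Y ∸ southStop n xs X Y)
        ∷ (X ∸ leftEnd n xs (southStop n xs X Y))
        ∷ paraRuns n xs f (leftEnd n xs (southStop n xs X Y)) (southStop n xs X Y))

ceilHalf : ℕ → ℕ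
ceilHalf zero          = 0
ceilHalf (suc zero)    = 1
ceilHalf (suc (suc i)) = suc (ceilHalf i)

cwsum : ℕ → List ℕ → ℕ
cwsum k []       = 0
cwsum k (c ∷ cs) = ceilHalf k * c + cwsum (suc k) cs

parabounce : ℕ → List ℕ → ℕ
parabounce n xs = cwsum 1 (paraRuns n xs (n + n) (n ∸ 1) (n ∸ 1))

Spoly : ℕ → Poly
Spoly n = map (λ xs → paraArea n xs , parabounce n xs) (lowerConfigs n)

shiftSquare : ℕ → Poly → Poly
shiftSquare k P = map (λ { (a , b) → (2 * k + a , 2 * k + 2 * b) }) P

module Submission where

-- The proof is an explicit bijection.  A configuration x = (x₁,…,x_m) of
-- LowerPara_{m+1,m} is sent to the Dyck path toPath m x of semi-length m
-- whose i-th south step (from the top) lies on the column x_i + 1.  Under it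
--   * area(diag x) = 2m + area(toPath m x), since row i of diag(x) is two
--     cells longer than the part of row i between the path and the diagonal;
--   * parabounce(diag x) = 2m + 2 hagbounce(toPath m x), since both bounce
--     paths turn south-to-west at the same heights, and the staircase upper
--     boundary of diag(x) sends the parallelogram path back to the diagonal,
--     so each Haglund run a(j) occurs twice, with weights ⌈(2j-1)/2⌉ = ⌈2j/2⌉ = j;
--     as Σ a(j) = m this gives 2 Σ j a(j) = 2m + 2 hagbounce.

open import Defs
open import Data.Bool using (true; false; T; _∧_; if_then_else_)
open import Data.Bool.Properties using (T-∧)
open import Data.Empty using (⊥-elim)
open import Relation.Nullary using (¬_; yes; no)
open import Relation.Nullary.Decidable using (T?)
open import Data.Nat using (ℕ; zero; suc; _+_; _*_; _∸_; _≤_; _<_; z≤n; s≤s; s≤s⁻¹; _≤ᵇ_; _≡ᵇ_; _<ᵇ_)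
open import Data.Nat.Properties
open import Data.List using (List; []; _∷_; map; _++_; concatMap; cartesianProductWith; upTo; length; replicate; drop)
open import Data.List.Properties using (∷-injective; upTo-∷ʳ; map-id-local; map-cong-local; map-∘; map-cong; ++-identityʳ)
open import Data.List.Relation.Unary.All as All using (All; []; _∷_)
open import Data.List.Relation.Unary.Any using (here; there)
open import Data.List.Relation.Unary.AllPairs using ([]; _∷_)
open import Data.List.Membership.Propositional using (_∈_)
open import Data.List.Membership.Propositional.Properties
  using (∈-cartesianProductWith⁺; ∈-cartesianProductWith⁻; ∈-map⁺; ∈-map⁻; ∈-filter⁺; ∈-filter⁻; ∈-upTo⁺)
open import Data.List.Membership.Propositional.Properties.WithK using (unique∧set⇒bag)
open import Data.List.Relation.Unary.Unique.Propositional using (Unique)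
import Data.List.Relation.Unary.Unique.Propositional.Properties as Unique
open import Data.List.Relation.Binary.Permutation.Propositional using (_↭_; module PermutationReasoning)
open import Data.List.Relation.Binary.Permutation.Propositional.Properties using (map⁺)
open import Data.List.Relation.Binary.BagAndSetEquality using (∼bag⇒↭)
open import Data.Product using (_×_; _,_; proj₁; proj₂)
open import Data.Nat.ListAction using (sum)
open import Data.Nat.Tactic.RingSolver using (solve-∀)
open import Function using (_∘_; _⇔_; mk⇔; Equivalence)
open import Relation.Binary.PropositionalEquality

words : {A : Set} → List A → ℕ → List (List A)
words V zero    = [] ∷ []
words V (suc k) = cartesianProductWith _∷_ V (words V k)

prependAll≡product : {A : Set} (V : List A) (R : List (List A)) →
  concatMap (λ v → map (v ∷_) R) V ≡ cartesianProductWith _∷_ V R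
prependAll≡product []      R = refl
prependAll≡product (v ∷ V) R = cong (map (v ∷_) R ++_) (prependAll≡product V R)

upToIncl≡upTo : ∀ b → upToIncl b ≡ upTo (suc b)
upToIncl≡upTo zero    = refl
upToIncl≡upTo (suc b) = trans (cong (_++ suc b ∷ []) (upToIncl≡upTo b)) (upTo-∷ʳ (suc b))

allLists≡words : ∀ k b → allLists k b ≡ words (upTo (suc b)) k
allLists≡words zero    b = refl
allLists≡words (suc k) b =
  trans (prependAll≡product (upToIncl b) (allLists k b))
        (cong₂ (cartesianProductWith _∷_) (upToIncl≡upTo b) (allLists≡words k b))

allStepLists≡words : ∀ k → allStepLists k ≡ words (true ∷ false ∷ []) k
allStepLists≡words zero    = refl
allStepLists≡words (suc k) =
  trans (prependAll≡product (true ∷ false ∷ []) (allStepLists k))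
        (cong (cartesianProductWith _∷_ (true ∷ false ∷ [])) (allStepLists≡words k))

module _ {A : Set} {V : List A} where

  words-unique : Unique V → ∀ k → Unique (words V k)
  words-unique uV zero    = [] ∷ []
  words-unique uV (suc k) = Unique.cartesianProductWith⁺ _∷_ ∷-injective uV (words-unique uV k)

  ∈-words⁺ : ∀ {w} → All (_∈ V) w → w ∈ words V (length w)
  ∈-words⁺ []         = here refl
  ∈-words⁺ (v∈ ∷ w∈)  = ∈-cartesianProductWith⁺ _∷_ v∈ (∈-words⁺ w∈)

  length-∈-words : ∀ k {w} → w ∈ words V k → length w ≡ k
  length-∈-words zero    (here refl) = refl
  length-∈-words (suc k) w∈ with _ , _ , _ , u∈ , refl ← ∈-cartesianProductWith⁻ _∷_ V (words V k) w∈
    = cong suc (length-∈-words k u∈)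

unique-sameElements⇒↭ : {A : Set} {xs ys : List A} → Unique xs → Unique ys →
  (∀ {z} → z ∈ xs ⇔ z ∈ ys) → xs ↭ ys
unique-sameElements⇒↭ uxs uys same = ∼bag⇒↭ (unique∧set⇒bag uxs uys same)

map-↭-of-inverses : {A B : Set} (f : A → B) (g : B → A) {xs : List A} {ys : List B} →
  Unique xs → Unique ys →
  (∀ {x} → x ∈ xs → f x ∈ ys × g (f x) ≡ x) →
  (∀ {y} → y ∈ ys → g y ∈ xs × f (g y) ≡ y) →
  map f xs ↭ ys
map-↭-of-inverses f g {xs} {ys} uxs uys forth back =
  unique-sameElements⇒↭ unique-image uys (mk⇔ image⊆ys ys⊆image)
  where
  g∘f≡id : map g (map f xs) ≡ xs
  g∘f≡id = trans (sym (map-∘ xs)) (map-id-local (All.tabulate (λ x∈ → proj₂ (forth x∈))))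

  unique-image : Unique (map f xs)
  unique-image = Unique.map⁻ (subst Unique (sym g∘f≡id) uxs)

  image⊆ys : ∀ {y} → y ∈ map f xs → y ∈ ys
  image⊆ys y∈ with _ , x∈ , refl ← ∈-map⁻ f y∈ = proj₁ (forth x∈)

  ys⊆image : ∀ {y} → y ∈ ys → y ∈ map f xs
  ys⊆image y∈ = subst (_∈ map f xs) (proj₂ (back y∈)) (∈-map⁺ f (proj₁ (back y∈)))

T-∧⁻ : ∀ {a b} → T (a ∧ b) → T a × T b
T-∧⁻ = Equivalence.to T-∧

T-∧⁺ : ∀ {a b} → T a → T b → T (a ∧ b)
T-∧⁺ p q = Equivalence.from T-∧ (p , q)

if-true : ∀ {A : Set} {b} {x y : A} → T b → (if b then x else y) ≡ x
if-true {b = true} _ = refl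

if-false : ∀ {A : Set} {b} {x y : A} → ¬ T b → (if b then x else y) ≡ y
if-false {b = true}  ¬t = ⊥-elim (¬t _)
if-false {b = false} _  = refl

-- Decreasing c xs : xs is weakly decreasing and all its entries are below c.
data Decreasing : ℕ → List ℕ → Set where
  []  : ∀ {c} → Decreasing c []
  _∷_ : ∀ {c x xs} → x < c → Decreasing (suc x) xs → Decreasing c (x ∷ xs)

-- Staircase Y xs : xs = (x₁,…,x_Y) has length Y and x_i ≥ Y - i.
data Staircase : ℕ → List ℕ → Set where
  []  : Staircase 0 []
  _∷_ : ∀ {Y x xs} → Y ≤ x → Staircase Y xs → Staircase (suc Y) (x ∷ xs)

-- x = (x₁,…,x_m) is a weakly decreasing recurrent configuration on K_{m+1}:
-- m > x₁ ≥ ⋯ ≥ x_m and x_i ≥ m - i.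
Config : ℕ → List ℕ → Set
Config m xs = Decreasing m xs × Staircase m xs

length-staircase : ∀ {Y xs} → Staircase Y xs → length xs ≡ Y
length-staircase []       = refl
length-staircase (_ ∷ st) = cong suc (length-staircase st)

decreasing-weaken : ∀ {c d xs} → c ≤ d → Decreasing c xs → Decreasing d xs
decreasing-weaken c≤d []         = []
decreasing-weaken c≤d (x<c ∷ ds) = ≤-trans x<c c≤d ∷ ds

decreasing-bound : ∀ {c xs} → Decreasing c xs → All (_< c) xs
decreasing-bound []         = []
decreasing-bound (x<c ∷ ds) = x<c ∷ All.map (λ y<sx → <-≤-trans y<sx x<c) (decreasing-bound ds)

decreasing⇒test : ∀ {c xs} → Decreasing c xs → T (weaklyDecreasing xs)
decreasing⇒test []                    = _
decreasing⇒test (_ ∷ [])              = _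
decreasing⇒test (_ ∷ y<sx ∷ ds) = T-∧⁺ (≤⇒≤ᵇ (s≤s⁻¹ y<sx)) (decreasing⇒test (y<sx ∷ ds))

test⇒decreasing : ∀ {c x xs} → x < c → T (weaklyDecreasing (x ∷ xs)) → Decreasing c (x ∷ xs)
test⇒decreasing {xs = []}     x<c _ = x<c ∷ []
test⇒decreasing {x = x} {xs = y ∷ ys} x<c t with y≤x , rest ← T-∧⁻ t =
  x<c ∷ test⇒decreasing (s≤s (≤ᵇ⇒≤ y x y≤x)) rest

-- In boundsFrom n i, the entry x_i with L entries after it must satisfy
-- x_i ≥ n - 1 - i, which is L when the list ends at index n - 1.
staircase-offset : ∀ i L → (i + suc L) ∸ 1 ∸ i ≡ L
staircase-offset i L = trans (cong (λ k → k ∸ 1 ∸ i) (+-suc i L)) (m+n∸m≡n i L)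

bounds⇒staircase : ∀ n i xs → i + length xs ≡ n → T (boundsFrom n i xs) →
  Staircase (length xs) xs
bounds⇒staircase n i []       _ _ = []
bounds⇒staircase n i (x ∷ xs) refl t
  with _ , low∧rest ← T-∧⁻ {x ≤ᵇ n ∸ 2} t
  with low , rest ← T-∧⁻ low∧rest =
  subst (_≤ x) (staircase-offset i (length xs)) (≤ᵇ⇒≤ _ x low)
  ∷ bounds⇒staircase n (suc i) xs (sym (+-suc i (length xs))) rest

staircase⇒bounds : ∀ n i {L xs} → Staircase L xs → i + L ≡ n → All (_≤ n ∸ 2) xs →
  T (boundsFrom n i xs)
staircase⇒bounds n i []                       _    []          = _
staircase⇒bounds n i {suc L} {x ∷ _} (L≤x ∷ st) refl (x≤ ∷ x≤s) =
  T-∧⁺ (≤⇒≤ᵇ x≤) (T-∧⁺ (≤⇒≤ᵇ (subst (_≤ x) (sym (staircase-offset i L)) L≤x))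
    (staircase⇒bounds n (suc i) st (sym (+-suc i L)) x≤s))

config⇒test : ∀ {m xs} → Config m xs → T (isLowerConfig (suc m) xs)
config⇒test {m} (dec , st) =
  T-∧⁺ (decreasing⇒test dec)
       (staircase⇒bounds (suc m) 1 st refl (All.map <⇒≤pred (decreasing-bound dec)))

test⇒config : ∀ {m xs} → length xs ≡ m → T (isLowerConfig (suc m) xs) → Config m xs
test⇒config {xs = []}     refl _ = [] , []
test⇒config {xs = x ∷ xs} refl t with decreasing , bounds ← T-∧⁻ {weaklyDecreasing (x ∷ xs)} t =
  test⇒decreasing (s≤s (≤ᵇ⇒≤ x _ (proj₁ (T-∧⁻ bounds)))) decreasing ,
  bounds⇒staircase _ 1 (x ∷ xs) refl bounds

lowerConfigs-unique : ∀ m → Unique (lowerConfigs (suc m))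
lowerConfigs-unique m = Unique.filter⁺ (T? ∘ isLowerConfig (suc m))
  (subst Unique (sym (allLists≡words m (m ∸ 1))) (words-unique (Unique.upTo⁺ _) m))

∈-lowerConfigs⁻ : ∀ m {xs} → xs ∈ lowerConfigs (suc m) → Config m xs
∈-lowerConfigs⁻ m xs∈ with xs∈all , t ← ∈-filter⁻ (T? ∘ isLowerConfig (suc m)) xs∈ =
  test⇒config (length-∈-words m (subst (_ ∈_) (allLists≡words m (m ∸ 1)) xs∈all)) t

∈-lowerConfigs⁺ : ∀ m {xs} → Config m xs → xs ∈ lowerConfigs (suc m)
∈-lowerConfigs⁺ m {xs} cfg@(dec , st) =
  ∈-filter⁺ (T? ∘ isLowerConfig (suc m)) xs∈allLists (config⇒test cfg)
  where
  entry∈ : ∀ {x} → x < m → x ∈ upTo (suc (m ∸ 1))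
  entry∈ x<m = ∈-upTo⁺ (s≤s (<⇒≤pred x<m))

  xs∈allLists : xs ∈ allLists m (m ∸ 1)
  xs∈allLists = subst (xs ∈_) (sym (allLists≡words m (m ∸ 1)))
    (subst (λ k → xs ∈ words _ k) (length-staircase st)
      (∈-words⁺ (All.map entry∈ (decreasing-bound dec))))

validFrom-west : ∀ x y p → validFrom (suc x) y (false ∷ p) ≡ (y ≤ᵇ x) ∧ validFrom x y p
validFrom-west x zero    p = refl
validFrom-west x (suc y) p = refl

valid-west⁻ : ∀ {x y p} → T (validFrom (suc x) y (false ∷ p)) → y ≤ x × T (validFrom x y p)
valid-west⁻ {x} {y} {p} t with y≤x , valid ← T-∧⁻ (subst T (validFrom-west x y p) t) =
  ≤ᵇ⇒≤ y x y≤x , valid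

valid-west⁺ : ∀ {x y p} → y ≤ x → T (validFrom x y p) → T (validFrom (suc x) y (false ∷ p))
valid-west⁺ {x} {y} {p} y≤x valid = subst T (sym (validFrom-west x y p)) (T-∧⁺ (≤⇒≤ᵇ y≤x) valid)

length-valid : ∀ x y p → T (validFrom x y p) → length p ≡ x + y
length-valid x y [] t with x≡0 , y≡0 ← T-∧⁻ {x ≡ᵇ 0} t
  rewrite ≡ᵇ⇒≡ x 0 x≡0 | ≡ᵇ⇒≡ y 0 y≡0 = refl
length-valid x       zero    (true  ∷ p) ()
length-valid x       (suc y) (true  ∷ p) t = trans (cong suc (length-valid x y p t)) (sym (+-suc x y))
length-valid zero    zero    (false ∷ p) ()
length-valid zero    (suc y) (false ∷ p) ()
length-valid (suc x) y       (false ∷ p) t = cong suc (length-valid x y p (proj₂ (valid-west⁻ {x} {y} {p} t)))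

dyckPaths-unique : ∀ m → Unique (dyckPaths m)
dyckPaths-unique m = Unique.filter⁺ (T? ∘ isDyck m)
  (subst Unique (sym (allStepLists≡words (m + m))) (words-unique (((λ ()) ∷ []) ∷ [] ∷ []) (m + m)))

∈-dyckPaths⁻ : ∀ m {p} → p ∈ dyckPaths m → T (validFrom m m p)
∈-dyckPaths⁻ m p∈ = proj₂ (∈-filter⁻ (T? ∘ isDyck m) {xs = allStepLists (m + m)} p∈)

∈-dyckPaths⁺ : ∀ m {p} → T (validFrom m m p) → p ∈ dyckPaths m
∈-dyckPaths⁺ m {p} valid = ∈-filter⁺ (T? ∘ isDyck m) p∈allSteps valid
  where
  step∈ : ∀ (s : Step) → s ∈ true ∷ false ∷ []
  step∈ true  = here refl
  step∈ false = there (here refl)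

  p∈allSteps : p ∈ allStepLists (m + m)
  p∈allSteps = subst (p ∈_) (sym (allStepLists≡words (m + m)))
    (subst (λ k → p ∈ words _ k) (length-valid m m p valid) (∈-words⁺ (All.tabulate λ {s} _ → step∈ s)))

-- The configuration
-- x = (x₁,…,x_m) corresponds to the Dyck path whose i-th south step (from
-- the top) lies on the line X = x_i + 1; the staircase condition
-- x_i ≥ m - i is exactly the condition that the path stays below the
-- diagonal.

west : ℕ → List Step
west k = replicate k false

toPath : ℕ → List ℕ → List Step
toPath c []       = west c
toPath c (x ∷ xs) = west (c ∸ suc x) ++ true ∷ toPath (suc x) xs

toConfig : ℕ → List Step → List ℕ
toConfig c []          = []
toConfig c (false ∷ p) = toConfig (c ∸ 1) p
toConfig c (true  ∷ p) = (c ∸ 1) ∷ toConfig c p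

toPath-suc : ∀ {c xs} → Decreasing c xs → toPath (suc c) xs ≡ false ∷ toPath c xs
toPath-suc []                        = refl
toPath-suc (_∷_ {x = x} {xs} x<c _) = cong (λ k → west k ++ true ∷ toPath (suc x) xs) (+-∸-assoc 1 x<c)

toConfig-west : ∀ c k r → toConfig c (west k ++ r) ≡ toConfig (c ∸ k) r
toConfig-west c zero    r = refl
toConfig-west c (suc k) r = trans (toConfig-west (c ∸ 1) k r) (cong (λ d → toConfig d r) (∸-+-assoc c 1 k))

toConfig-toPath : ∀ {c xs} → Decreasing c xs → toConfig c (toPath c xs) ≡ xs
toConfig-toPath {c} [] = trans (cong (toConfig c) (sym (++-identityʳ (west c)))) (toConfig-west c c [])
toConfig-toPath {c} (_∷_ {x = x} {xs} x<c dec) = begin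
  toConfig c (west (c ∸ suc x) ++ true ∷ toPath (suc x) xs)
    ≡⟨ toConfig-west c (c ∸ suc x) _ ⟩
  toConfig (c ∸ (c ∸ suc x)) (true ∷ toPath (suc x) xs)
    ≡⟨ cong (λ d → toConfig d (true ∷ toPath (suc x) xs)) (m∸[m∸n]≡n x<c) ⟩
  x ∷ toConfig (suc x) (toPath (suc x) xs)
    ≡⟨ cong (x ∷_) (toConfig-toPath dec) ⟩
  x ∷ xs ∎
  where open ≡-Reasoning

valid-west : ∀ k c y r → k ≤ c → y ≤ c ∸ k → T (validFrom (c ∸ k) y r) →
  T (validFrom c y (west k ++ r))
valid-west zero    c       y r _         _   valid = valid
valid-west (suc k) (suc c) y r (s≤s k≤c) y≤ valid =
  valid-west⁺ (≤-trans y≤ (m∸n≤m c k)) (valid-west k c y r k≤c y≤ valid)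

toPath-valid : ∀ {c Y xs} → Decreasing c xs → Staircase Y xs → T (validFrom c Y (toPath c xs))
toPath-valid {c} [] [] =
  subst (λ p → T (validFrom c 0 p)) (++-identityʳ (west c)) (valid-west c c 0 [] ≤-refl z≤n valid-origin)
  where
  valid-origin : T (validFrom (c ∸ c) 0 [])
  valid-origin = subst (λ d → T (validFrom d 0 [])) (sym (n∸n≡0 c)) _
toPath-valid {c} {suc Y} (_∷_ {x = x} {xs} x<c dec) (Y≤x ∷ st) =
  valid-west (c ∸ suc x) c (suc Y) _ (m∸n≤m c (suc x)) (subst (suc Y ≤_) (sym column) (s≤s Y≤x))
    (subst (λ d → T (validFrom d (suc Y) (true ∷ toPath (suc x) xs))) (sym column) (toPath-valid dec st))
  where
  column : c ∸ (c ∸ suc x) ≡ suc x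
  column = m∸[m∸n]≡n x<c

toConfig-valid : ∀ c y p → y ≤ c → T (validFrom c y p) →
  Decreasing c (toConfig c p) × Staircase y (toConfig c p) × toPath c (toConfig c p) ≡ p
toConfig-valid c y [] y≤c t with c≡0 , y≡0 ← T-∧⁻ {c ≡ᵇ 0} t
  rewrite ≡ᵇ⇒≡ c 0 c≡0 | ≡ᵇ⇒≡ y 0 y≡0 = [] , [] , refl
toConfig-valid c zero (true ∷ p) y≤c ()
toConfig-valid (suc c) (suc y) (true ∷ p) (s≤s y≤c) t
  with dec , st , path ← toConfig-valid (suc c) y p (m≤n⇒m≤1+n y≤c) t
  rewrite n∸n≡0 c = ≤-refl ∷ dec , y≤c ∷ st , cong (true ∷_) path
toConfig-valid zero zero    (false ∷ p) y≤c ()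
toConfig-valid zero (suc y) (false ∷ p) y≤c ()
toConfig-valid (suc c) y (false ∷ p) y≤c t
  with y≤c , valid ← valid-west⁻ {c} {y} {p} t
  with dec , st , path ← toConfig-valid c y p y≤c valid =
  decreasing-weaken (n≤1+n c) dec , st , trans (toPath-suc dec) (cong (false ∷_) path)

-- Row i of diag(x) is [m - i, 2 + x_i], i.e. two cells longer than
-- the part x_i - (m - i) of row i lying between the Dyck path and the
-- diagonal; hence area(diag x) = 2m + area(toPath m x).

-- Σ_i (x_i - #{entries after x_i}) : the area between toPath and the diagonal.
excessArea : List ℕ → ℕ
excessArea []       = 0
excessArea (x ∷ xs) = (x ∸ length xs) + excessArea xs

areaFrom-west : ∀ k c y r → areaFrom c y (west k ++ r) ≡ areaFrom (c ∸ k) y r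
areaFrom-west zero    c y r = refl
areaFrom-west (suc k) c y r =
  trans (areaFrom-west k (c ∸ 1) y r) (cong (λ d → areaFrom d y r) (∸-+-assoc c 1 k))

area-toPath : ∀ {c xs} → Decreasing c xs → areaFrom c (length xs) (toPath c xs) ≡ excessArea xs
area-toPath {c} [] = trans (cong (areaFrom c 0) (sym (++-identityʳ (west c)))) (areaFrom-west c c 0 [])
area-toPath {c} (_∷_ {x = x} {xs} x<c dec) = begin
  areaFrom c (suc (length xs)) (west (c ∸ suc x) ++ true ∷ toPath (suc x) xs)
    ≡⟨ areaFrom-west (c ∸ suc x) c _ _ ⟩
  areaFrom (c ∸ (c ∸ suc x)) (suc (length xs)) (true ∷ toPath (suc x) xs)
    ≡⟨ cong (λ d → areaFrom d (suc (length xs)) (true ∷ toPath (suc x) xs)) (m∸[m∸n]≡n x<c) ⟩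
  (x ∸ length xs) + areaFrom (suc x) (length xs) (toPath (suc x) xs)
    ≡⟨ cong ((x ∸ length xs) +_) (area-toPath dec) ⟩
  excessArea (x ∷ xs) ∎
  where open ≡-Reasoning

rowWidth : ℕ × ℕ → ℕ
rowWidth (l , r) = r ∸ l

paraArea-rows : ∀ n xs → paraArea n xs ≡ sum (map rowWidth (diagRows n xs))
paraArea-rows n xs = cong sum (map-cong (λ { (l , r) → refl }) (diagRows n xs))

rows-area : ∀ n i {L xs} → Staircase L xs → i + L ≡ n →
  sum (map rowWidth (rowsFrom n i xs)) ≡ 2 * L + excessArea xs
rows-area n i []                            _ = refl
rows-area n i {suc L} {x ∷ xs} (L≤x ∷ st) refl = begin
  (2 + x) ∸ ((i + suc L) ∸ 1 ∸ i) + sum (map rowWidth (rowsFrom (i + suc L) (suc i) xs))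
    ≡⟨ cong₂ _+_ (cong ((2 + x) ∸_) (staircase-offset i L)) (rows-area _ (suc i) st (sym (+-suc i L))) ⟩
  (2 + x) ∸ L + (2 * L + excessArea xs)
    ≡⟨ cong (_+ (2 * L + excessArea xs)) (+-∸-assoc 2 L≤x) ⟩
  2 + (x ∸ L) + (2 * L + excessArea xs)
    ≡⟨ regroup (x ∸ L) L (excessArea xs) ⟩
  2 * suc L + ((x ∸ L) + excessArea xs)
    ≡⟨ cong (λ k → 2 * suc L + ((x ∸ k) + excessArea xs)) (sym (length-staircase st)) ⟩
  2 * suc L + excessArea (x ∷ xs) ∎
  where
  open ≡-Reasoning
  regroup : ∀ d L e → 2 + d + (2 * L + e) ≡ 2 * suc L + (d + e)
  regroup = solve-∀

area-transfer : ∀ {m xs} → Config m xs → paraArea (suc m) xs ≡ 2 * m + dyckArea m (toPath m xs)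
area-transfer {m} {xs} (dec , st) = begin
  paraArea (suc m) xs                       ≡⟨ paraArea-rows (suc m) xs ⟩
  sum (map rowWidth (diagRows (suc m) xs))  ≡⟨ rows-area (suc m) 1 st refl ⟩
  2 * m + excessArea xs                     ≡⟨ cong (2 * m +_) (sym dyckArea≡excess) ⟩
  2 * m + dyckArea m (toPath m xs)          ∎
  where
  open ≡-Reasoning
  dyckArea≡excess : areaFrom m m (toPath m xs) ≡ excessArea xs
  dyckArea≡excess = subst (λ L → areaFrom m L (toPath m xs) ≡ excessArea xs) (length-staircase st) (area-toPath dec)

-- Both bounce paths start at a diagonal point (X , X) and go
-- south along the column X.  For the Dyck path toPath m x the Haglund
-- bounce path turns where D has a west step starting on the column X; for the
-- polyomino diag(x) the parallelogram bounce path turns at the first row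
-- whose right end 2 + x_i does not exceed X.  These happen at the same
-- height, computed by 'descend'.  The polyomino path then goes west to its
-- staircase upper boundary, which is again on the diagonal, so each Haglund
-- run a(j) appears twice, as c(2j-1) = c(2j) = a(j).

-- descend X Y (x₁,x₂,…): the height reached walking south along the column
-- X from height Y past rows (from the top) with right ends 2 + x₁, 2 + x₂, …,
-- stopping at the first row that does not extend beyond X.
descend : ℕ → ℕ → List ℕ → ℕ
descend X zero    _        = 0
descend X (suc Y) []       = 0
descend X (suc Y) (x ∷ xs) = if X <ᵇ 2 + x then descend X Y xs else suc Y

descend-≤ : ∀ X Y xs → descend X Y xs ≤ Y
descend-≤ X zero    xs       = z≤n
descend-≤ X (suc Y) []       = z≤n
descend-≤ X (suc Y) (x ∷ xs) with X <ᵇ 2 + x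
... | true  = m≤n⇒m≤1+n (descend-≤ X Y xs)
... | false = ≤-refl

descend-< : ∀ X {ys} → Staircase (suc X) ys → descend (suc X) (suc X) ys ≤ X
descend-< X {y ∷ ys} (X≤y ∷ _) =
  subst (_≤ X) (sym (if-true (<⇒<ᵇ (s≤s (s≤s X≤y))))) (descend-≤ (suc X) X ys)

staircase-drop : ∀ k {Y xs} → Staircase (k + Y) xs → Staircase Y (drop k xs)
staircase-drop zero    st       = st
staircase-drop (suc k) (_ ∷ st) = staircase-drop k st

-- The rows above height X of a staircase all extend beyond the column X.
descend-skip : ∀ k X {xs} → Staircase (k + X) xs → descend X (k + X) xs ≡ descend X X (drop k xs)
descend-skip zero    X st = refl
descend-skip (suc k) X {x ∷ xs} (k+X≤x ∷ st) =
  trans (if-true (<⇒<ᵇ (s≤s (m≤n⇒m≤1+n (≤-trans (m≤n+m X k) k+X≤x))))) (descend-skip k X st)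

drop≡nth∷drop : ∀ xs j → j < length xs → drop j xs ≡ nth xs j ∷ drop (suc j) xs
drop≡nth∷drop (x ∷ xs) zero    _         = refl
drop≡nth∷drop (x ∷ xs) (suc j) (s≤s j<n) = drop≡nth∷drop xs j j<n

m∸n≡1+m∸1+n : ∀ {m n} → n < m → m ∸ n ≡ suc (m ∸ suc n)
m∸n≡1+m∸1+n {suc m} (s≤s n≤m) = +-∸-assoc 1 n≤m

-- The south run of the parallelogram bounce path, read off the rows below
-- height Y (the rows of diag(x) are listed from the top).
southStop-descend : ∀ {m} xs X Y → length xs ≡ m → Y ≤ m →
  southStop (suc m) xs X Y ≡ descend X Y (drop (m ∸ Y) xs)
southStop-descend xs X zero    _   _   = refl
southStop-descend {m} xs X (suc Y) len Y<m = begin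
  (if X <ᵇ 2 + nth xs (m ∸ 1 ∸ Y) then southStop (suc m) xs X Y else suc Y)
    ≡⟨ cong (λ j → if X <ᵇ 2 + nth xs j then southStop (suc m) xs X Y else suc Y) (∸-+-assoc m 1 Y) ⟩
  (if X <ᵇ 2 + nth xs (m ∸ suc Y) then southStop (suc m) xs X Y else suc Y)
    ≡⟨ cong (λ s → if X <ᵇ 2 + nth xs (m ∸ suc Y) then s else suc Y)
            (southStop-descend xs X Y len (<⇒≤ Y<m)) ⟩
  (if X <ᵇ 2 + nth xs (m ∸ suc Y) then descend X Y (drop (m ∸ Y) xs) else suc Y)
    ≡⟨ cong (λ k → if X <ᵇ 2 + nth xs (m ∸ suc Y) then descend X Y (drop k xs) else suc Y)
            (m∸n≡1+m∸1+n Y<m) ⟩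
  descend X (suc Y) (nth xs (m ∸ suc Y) ∷ drop (suc (m ∸ suc Y)) xs)
    ≡⟨ cong (descend X (suc Y)) (sym (drop≡nth∷drop xs (m ∸ suc Y) row-exists)) ⟩
  descend X (suc Y) (drop (m ∸ suc Y) xs) ∎
  where
  open ≡-Reasoning
  row-exists : m ∸ suc Y < length xs
  row-exists = subst (m ∸ suc Y <_) (sym len) (subst (_≤ m) (m∸n≡1+m∸1+n Y<m) (m∸n≤m m Y))

lowFrom-west-pass : ∀ X k c y r → X ≤ c ∸ k → k ≤ c →
  lowFrom X c y (west k ++ r) ≡ lowFrom X (c ∸ k) y r
lowFrom-west-pass X zero    c       y r _   _         = refl
lowFrom-west-pass X (suc k) (suc c) y r X≤ (s≤s k≤c) =
  trans (if-false (λ t → <-irrefl (sym (≡ᵇ⇒≡ (suc c) X t)) (s≤s (≤-trans X≤ (m∸n≤m c k)))))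
        (lowFrom-west-pass X k c y r X≤ k≤c)

lowFrom-west-hit : ∀ X k c y r → c ∸ k < X → X ≤ c → lowFrom X c y (west k ++ r) ≡ y
lowFrom-west-hit X zero    c       y r c<X X≤c = ⊥-elim (<-irrefl refl (<-≤-trans c<X X≤c))
lowFrom-west-hit X (suc k) zero    y r c<X X≤c = ⊥-elim (<-irrefl refl (<-≤-trans c<X X≤c))
lowFrom-west-hit X (suc k) (suc c) y r c<X X≤c with T? (suc c ≡ᵇ X)
... | yes t = if-true t
... | no ¬t = trans (if-false ¬t)
  (lowFrom-west-hit X k c y r c<X (s≤s⁻¹ (≤∧≢⇒< X≤c (λ X≡ → ¬t (≡⇒≡ᵇ (suc c) X (sym X≡))))))

lowFrom-west-end : ∀ X k c → lowFrom X c 0 (west k) ≡ 0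
lowFrom-west-end X zero    c = refl
lowFrom-west-end X (suc k) c with c ≡ᵇ X
... | true  = refl
... | false = lowFrom-west-end X k (c ∸ 1)

low-toPath : ∀ X {c xs} → X ≤ c → Decreasing c xs →
  lowFrom X c (length xs) (toPath c xs) ≡ descend X (length xs) xs
low-toPath X {c} X≤c [] = lowFrom-west-end X c c
low-toPath X {c} X≤c (_∷_ {x = x} {xs} x<c dec) with X ≤? suc x
... | yes X≤sx = begin
  lowFrom X c (suc (length xs)) (west (c ∸ suc x) ++ true ∷ toPath (suc x) xs)
    ≡⟨ lowFrom-west-pass X (c ∸ suc x) c _ _ (subst (X ≤_) (sym column) X≤sx) (m∸n≤m c (suc x)) ⟩
  lowFrom X (c ∸ (c ∸ suc x)) (suc (length xs)) (true ∷ toPath (suc x) xs)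
    ≡⟨ cong (λ d → lowFrom X d (suc (length xs)) (true ∷ toPath (suc x) xs)) column ⟩
  lowFrom X (suc x) (length xs) (toPath (suc x) xs)
    ≡⟨ low-toPath X X≤sx dec ⟩
  descend X (length xs) xs
    ≡⟨ sym (if-true (<⇒<ᵇ (s≤s X≤sx))) ⟩
  descend X (suc (length xs)) (x ∷ xs) ∎
  where
  open ≡-Reasoning
  column : c ∸ (c ∸ suc x) ≡ suc x
  column = m∸[m∸n]≡n x<c
... | no X≰sx =
  trans (lowFrom-west-hit X (c ∸ suc x) c _ _ (subst (_< X) (sym (m∸[m∸n]≡n x<c)) (≰⇒> X≰sx)) X≤c)
        (sym (if-false (λ t → X≰sx (s≤s⁻¹ (<ᵇ⇒< X (2 + x) t)))))

leftEnd-diagonal : ∀ m xs s → s ≤ m → leftEnd (suc m) xs s ≡ s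
leftEnd-diagonal m xs s s≤m = m∸[m∸n]≡n s≤m

doubleEach : List ℕ → List ℕ
doubleEach []       = []
doubleEach (a ∷ as) = a ∷ a ∷ doubleEach as

module BouncePaths {m xs} (dec : Decreasing m xs) (st : Staircase m xs) where

  path : List Step
  path = toPath m xs

  low : ℕ → ℕ
  low X = lowFrom X m m path

  low≡descend : ∀ X → X ≤ m → low X ≡ descend X X (drop (m ∸ X) xs)
  low≡descend X X≤m = begin
    lowFrom X m m path             ≡⟨ cong (λ L → lowFrom X m L path) (sym len) ⟩
    lowFrom X m (length xs) path   ≡⟨ low-toPath X X≤m dec ⟩
    descend X (length xs) xs       ≡⟨ cong (λ Y → descend X Y xs) (trans len (sym (m∸n+n≡m X≤m))) ⟩
    descend X (m ∸ X + X) xs       ≡⟨ descend-skip (m ∸ X) X (subst (λ Y → Staircase Y xs) (sym (m∸n+n≡m X≤m)) st) ⟩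
    descend X X (drop (m ∸ X) xs)  ∎
    where
    open ≡-Reasoning
    len : length xs ≡ m
    len = length-staircase st

  southStop≡low : ∀ X → X ≤ m → southStop (suc m) xs X X ≡ low X
  southStop≡low X X≤m = trans (southStop-descend xs X X (length-staircase st) X≤m) (sym (low≡descend X X≤m))

  low-< : ∀ X → suc X ≤ m → low (suc X) ≤ X
  low-< X X<m = subst (_≤ X) (sym (low≡descend (suc X) X<m))
    (descend-< X (staircase-drop (m ∸ suc X) (subst (λ Y → Staircase Y xs) (sym (m∸n+n≡m X<m)) st)))

  low-≤m : ∀ X → suc X ≤ m → low (suc X) ≤ m
  low-≤m X X<m = ≤-trans (low-< X X<m) (<⇒≤ X<m)

  paraRuns-doubled : ∀ f g X → X ≤ f → X ≤ g → X ≤ m →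
    paraRuns (suc m) xs g X X ≡ doubleEach (hagRuns m path f X)
  paraRuns-doubled zero    zero    zero _ _ _ = refl
  paraRuns-doubled (suc f) zero    zero _ _ _ = refl
  paraRuns-doubled zero    (suc g) zero _ _ _ = refl
  paraRuns-doubled (suc f) (suc g) zero _ _ _ = refl
  paraRuns-doubled (suc f) (suc g) (suc X) (s≤s X≤f) (s≤s X≤g) X<m = begin
    (suc X ∸ s) ∷ (suc X ∸ leftEnd (suc m) xs s) ∷ paraRuns (suc m) xs g (leftEnd (suc m) xs s) s
      ≡⟨ cong (λ t → (suc X ∸ t) ∷ (suc X ∸ leftEnd (suc m) xs t) ∷ paraRuns (suc m) xs g (leftEnd (suc m) xs t) t)
              (southStop≡low (suc X) X<m) ⟩
    (suc X ∸ l) ∷ (suc X ∸ leftEnd (suc m) xs l) ∷ paraRuns (suc m) xs g (leftEnd (suc m) xs l) l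
      ≡⟨ cong (λ e → (suc X ∸ l) ∷ (suc X ∸ e) ∷ paraRuns (suc m) xs g e l)
              (leftEnd-diagonal m xs l (low-≤m X X<m)) ⟩
    (suc X ∸ l) ∷ (suc X ∸ l) ∷ paraRuns (suc m) xs g l l
      ≡⟨ cong (λ r → (suc X ∸ l) ∷ (suc X ∸ l) ∷ r)
              (paraRuns-doubled f g l (≤-trans (low-< X X<m) X≤f) (≤-trans (low-< X X<m) X≤g) (low-≤m X X<m)) ⟩
    doubleEach (hagRuns m path (suc f) (suc X)) ∎
    where
    open ≡-Reasoning
    s : ℕ
    s = southStop (suc m) xs (suc X) (suc X)
    l : ℕ
    l = low (suc X)

  sum-hagRuns : ∀ f X → X ≤ f → X ≤ m → sum (hagRuns m path f X) ≡ X
  sum-hagRuns zero    zero    _         _   = refl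
  sum-hagRuns (suc f) zero    _         _   = refl
  sum-hagRuns (suc f) (suc X) (s≤s X≤f) X<m = begin
    (suc X ∸ low (suc X)) + sum (hagRuns m path f (low (suc X)))
      ≡⟨ cong ((suc X ∸ low (suc X)) +_) (sum-hagRuns f (low (suc X)) (≤-trans (low-< X X<m) X≤f) (low-≤m X X<m)) ⟩
    (suc X ∸ low (suc X)) + low (suc X)
      ≡⟨ m∸n+n≡m (m≤n⇒m≤1+n (low-< X X<m)) ⟩
    suc X ∎
    where open ≡-Reasoning

-- The weights ⌈i/2⌉ on a doubled sequence: positions 2j-1 and 2j both get j.
ceilHalf-even : ∀ k → ceilHalf (k + k) ≡ k
ceilHalf-even zero    = refl
ceilHalf-even (suc k) = trans (cong (ceilHalf ∘ suc) (+-suc k k)) (cong suc (ceilHalf-even k))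

ceilHalf-odd : ∀ k → ceilHalf (suc (k + k)) ≡ suc k
ceilHalf-odd zero    = refl
ceilHalf-odd (suc k) = cong suc (trans (cong ceilHalf (+-suc k k)) (ceilHalf-odd k))

cwsum-doubleEach : ∀ k as → cwsum (suc (k + k)) (doubleEach as) ≡ 2 * wsum (suc k) as
cwsum-doubleEach k []       = refl
cwsum-doubleEach k (a ∷ as) = begin
  ceilHalf (suc (k + k)) * a + (suc (ceilHalf (k + k)) * a + cwsum (suc (suc (suc (k + k)))) (doubleEach as))
    ≡⟨ cong₂ (λ u v → u * a + (suc v * a + cwsum (suc (suc (suc (k + k)))) (doubleEach as)))
             (ceilHalf-odd k) (ceilHalf-even k) ⟩
  suc k * a + (suc k * a + cwsum (suc (suc (suc (k + k)))) (doubleEach as))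
    ≡⟨ cong (λ j → suc k * a + (suc k * a + cwsum (suc (suc j)) (doubleEach as))) (sym (+-suc k k)) ⟩
  suc k * a + (suc k * a + cwsum (suc (suc k + suc k)) (doubleEach as))
    ≡⟨ cong (λ w → suc k * a + (suc k * a + w)) (cwsum-doubleEach (suc k) as) ⟩
  suc k * a + (suc k * a + 2 * wsum (suc (suc k)) as)
    ≡⟨ double (suc k * a) (wsum (suc (suc k)) as) ⟩
  2 * wsum (suc k) (a ∷ as) ∎
  where
  open ≡-Reasoning
  double : ∀ u w → u + (u + 2 * w) ≡ 2 * (u + w)
  double = solve-∀

wsum-suc : ∀ k as → wsum (suc k) as ≡ wsum k as + sum as
wsum-suc k []       = refl
wsum-suc k (a ∷ as) = begin
  suc k * a + wsum (suc (suc k)) as        ≡⟨ cong (suc k * a +_) (wsum-suc (suc k) as) ⟩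
  suc k * a + (wsum (suc k) as + sum as)   ≡⟨ regroup k a (wsum (suc k) as) (sum as) ⟩
  k * a + wsum (suc k) as + (a + sum as)   ∎
  where
  open ≡-Reasoning
  regroup : ∀ k a w s → suc k * a + (w + s) ≡ k * a + w + (a + s)
  regroup = solve-∀

bounce-transfer : ∀ {m xs} → Config m xs →
  parabounce (suc m) xs ≡ 2 * m + 2 * hagbounce m (toPath m xs)
bounce-transfer {m} {xs} (dec , st) = begin
  cwsum 1 (paraRuns (suc m) xs (suc m + suc m) m m)
    ≡⟨ cong (cwsum 1) (paraRuns-doubled m (suc m + suc m) m ≤-refl (≤-trans (n≤1+n m) (m≤m+n (suc m) (suc m))) ≤-refl) ⟩
  cwsum 1 (doubleEach runs)            ≡⟨ cwsum-doubleEach 0 runs ⟩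
  2 * wsum 1 runs                      ≡⟨ cong (2 *_) (wsum-suc 0 runs) ⟩
  2 * (wsum 0 runs + sum runs)         ≡⟨ cong (λ s → 2 * (wsum 0 runs + s)) (sum-hagRuns m m ≤-refl ≤-refl) ⟩
  2 * (hagbounce m path + m)           ≡⟨ regroup (hagbounce m path) m ⟩
  2 * m + 2 * hagbounce m path         ∎
  where
  open ≡-Reasoning
  open BouncePaths dec st
  runs : List ℕ
  runs = hagRuns m path m m
  regroup : ∀ h m → 2 * (h + m) ≡ 2 * m + 2 * h
  regroup = solve-∀

toPath-bijection : ∀ m → map (toPath m) (lowerConfigs (suc m)) ↭ dyckPaths m
toPath-bijection m =
  map-↭-of-inverses (toPath m) (toConfig m) (lowerConfigs-unique m) (dyckPaths-unique m) forth back
  where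
  forth : ∀ {xs} → xs ∈ lowerConfigs (suc m) → toPath m xs ∈ dyckPaths m × toConfig m (toPath m xs) ≡ xs
  forth xs∈ with dec , st ← ∈-lowerConfigs⁻ m xs∈ = ∈-dyckPaths⁺ m (toPath-valid dec st) , toConfig-toPath dec

  back : ∀ {p} → p ∈ dyckPaths m → toConfig m p ∈ lowerConfigs (suc m) × toPath m (toConfig m p) ≡ p
  back p∈ with dec , st , path ← toConfig-valid m m _ ≤-refl (∈-dyckPaths⁻ m p∈) =
    ∈-lowerConfigs⁺ m (dec , st) , path

shiftedMonomial : ℕ → List Step → ℕ × ℕ
shiftedMonomial m p = 2 * m + dyckArea m p , 2 * m + 2 * hagbounce m p

shiftSquare-Cpoly : ∀ m → shiftSquare m (Cpoly m) ≡ map (shiftedMonomial m) (dyckPaths m)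
shiftSquare-Cpoly m = sym (map-∘ (dyckPaths m))

monomial-transfer : ∀ {m xs} → Config m xs →
  (paraArea (suc m) xs , parabounce (suc m) xs) ≡ shiftedMonomial m (toPath m xs)
monomial-transfer cfg = cong₂ _,_ (area-transfer cfg) (bounce-transfer cfg)

mainTheorem19 : (m : ℕ) → Spoly (suc m) ↭ shiftSquare m (Cpoly m)
mainTheorem19 m = begin
  Spoly (suc m)
    ≡⟨ map-cong-local (All.tabulate (monomial-transfer ∘ ∈-lowerConfigs⁻ m)) ⟩
  map (shiftedMonomial m ∘ toPath m) (lowerConfigs (suc m))
    ≡⟨ map-∘ (lowerConfigs (suc m)) ⟩
  map (shiftedMonomial m) (map (toPath m) (lowerConfigs (suc m)))
    ↭⟨ map⁺ (shiftedMonomial m) (toPath-bijection m) ⟩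
  map (shiftedMonomial m) (dyckPaths m)
    ≡⟨ shiftSquare-Cpoly m ⟨
  shiftSquare m (Cpoly m) ∎
  where open PermutationReasoning
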